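{- Let $k\ge2$ and let $\mathcal F(k)$ be the class of graphs with at most $k^3$ vertices. Then there are no graphs $G$ and $H$ such that $\hom(G,F)=\hom(H,F)$ for all $F\in\mathcal F(k)$, $|V(G)|\le k$ and $|V(H)|>k$.
   Context: Graphs are finite, simple, undirected, with non-empty vertex set. $\hom(G,F)$ is the number of homomorphisms from $G$ to $F$. -}

module Defs where

open import Data.Nat using (ℕ; zero; suc; _+_; _≤_)
open import Data.Bool using (Bool; true; false; _∧_; if_then_else_)
open import Data.Fin using (Fin)
open import Data.List using (List; []; _∷_; map; concatMap; allFin; length; filter)
open import Data.Vec.Functional using (Vector)
open import Relation.Binary.PropositionalEquality using (_≡_)

record Graph (n : ℕ) : Set where
  field
    adj   : Fin n → Fin n → Bool
    sym   : ∀ i j → adj i j ≡ adj j i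
    irref : ∀ i → adj i i ≡ false
open Graph public

allMaps : (n m : ℕ) → List (Fin n → Fin m)
allMaps zero    m = (λ ()) ∷ []
allMaps (suc n) m =
  concatMap (λ x → map (λ f → λ { Fin.zero → x ; (Fin.suc i) → f i }) (allMaps n m)) (allFin m)

allB : (n : ℕ) → (Fin n → Bool) → Bool
allB zero    p = true
allB (suc n) p = p Fin.zero ∧ allB n (λ i → p (Fin.suc i))

isHom : {n m : ℕ} → Graph n → Graph m → (Fin n → Fin m) → Bool
isHom {n} G F f =
  allB n (λ i → allB n (λ j → if adj G i j then adj F (f i) (f j) else true))

hom : {n m : ℕ} → Graph n → Graph m → ℕ
hom {n} {m} G F = length (filter (λ f → isHom G F f Data.Bool.≟ true) (allMaps n m))
  where import Data.Bool

-- Let K be the complete graph on k vertices and K² the graph obtained from K by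
-- replacing every vertex with two non-adjacent copies; both have at most k³
-- vertices. A homomorphism X → K² is a homomorphism X → K together with an
-- independent choice of copy for every vertex of X, so hom(X, K²) = 2^|V(X)| hom(X, K).
-- As |V(G)| ≤ k, G maps injectively into K and hom(G, K) > 0. If G and H had the
-- same homomorphism counts into K and K², then 2^|V(G)| = 2^|V(H)|, contradicting
-- |V(G)| ≤ k < |V(H)|.
module Submission where

open import Defs hiding (sym)
open import Data.Bool using (Bool; true; false; not; if_then_else_; _∧_; _≟_)
open import Data.Fin using (Fin; zero; suc; _↑ˡ_; _↑ʳ_; inject≤) renaming (_≟_ to _≟ᶠ_)
open import Data.Fin.Properties using (inject≤-injective)
open import Data.List using (List; []; _∷_; [_]; _++_; map; concatMap; tabulate; length; filter)
open import Data.List.Properties using (filter-++; filter-≐; filter-some; length-++)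
open import Data.List.Relation.Unary.Any as Any using (Any; here)
open import Data.List.Relation.Unary.Any.Properties using (concatMap⁺; tabulate⁺; map⁺)
open import Data.Nat using (ℕ; zero; suc; _+_; _*_; _^_; _≤_; _<_; z≤n; s≤s; >-nonZero)
open import Data.Nat.Properties
  using ( +-*-semiring; +-assoc; +-identityʳ; *-assoc; *-identityˡ; m≤m+n; m≤m*n; *-monoˡ-≤
        ; *-monoˡ-<; ^-monoʳ-<; ≤-trans; ≤-<-trans; <-irrefl; module ≤-Reasoning)
open import Algebra.Properties.Semiring.Sum +-*-semiring using (sum; sum-cong-≗; *-distribˡ-sum)
open import Data.Product using (Σ; _×_; _,_)
open import Data.Vec.Functional as Vector using (Vector)
open import Data.Vec.Functional.Properties using (lookup-++ˡ; lookup-++ʳ)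
open import Function using (_∘_; id)
open import Function.Definitions using (Injective)
open import Relation.Binary.Core using (_Preserves_⟶_)
open import Relation.Binary.PropositionalEquality
  using (_≡_; refl; sym; trans; cong; cong₂; _≗_; module ≡-Reasoning)
open import Relation.Nullary using (¬_; yes; no; does; contradiction)
open import Relation.Nullary.Decidable using (dec-true; dec-false)

private
  variable
    A B : Set
    k m m′ n : ℕ

count : (A → Bool) → List A → ℕ
count p = length ∘ filter (λ x → p x ≟ true)

count-cong : {p q : A → Bool} → p ≗ q → count p ≗ count q
count-cong p≗q = cong length ∘ filter-≐ _ _ ((λ {x} → trans (sym (p≗q x))) , (λ {x} → trans (p≗q x)))

count-++ : (p : A → Bool) (xs ys : List A) → count p (xs ++ ys) ≡ count p xs + count p ys
count-++ p xs ys = trans (cong length (filter-++ _ xs ys)) (length-++ (filter _ xs))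

count-map : (p : B → Bool) (f : A → B) (xs : List A) → count p (map f xs) ≡ count (p ∘ f) xs
count-map p f [] = refl
count-map p f (x ∷ xs) with p (f x)
... | true  = cong suc (count-map p f xs)
... | false = count-map p f xs

count-[-] : (p : A → Bool) (q : B → Bool) {x : A} {y : B} → p x ≡ q y → count p [ x ] ≡ count q [ y ]
count-[-] p q {x} {y} eq with p x | q y | eq
... | true  | .true  | refl = refl
... | false | .false | refl = refl

count-concatMap-tabulate : (p : B → Bool) (g : A → List B) (t : Fin n → A) →
  count p (concatMap g (tabulate t)) ≡ sum (λ i → count p (g (t i)))
count-concatMap-tabulate {n = zero}  p g t = refl
count-concatMap-tabulate {n = suc n} p g t =
  trans (count-++ p (g (t zero)) _) (cong (count p (g (t zero)) +_) (count-concatMap-tabulate p g (t ∘ suc)))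

sum-↑ˡ-↑ʳ : ∀ a b (T : Vector ℕ (a + b)) → sum T ≡ sum (T ∘ (_↑ˡ b)) + sum (T ∘ (a ↑ʳ_))
sum-↑ˡ-↑ʳ zero    b T = refl
sum-↑ˡ-↑ʳ (suc a) b T = trans (cong (T zero +_) (sum-↑ˡ-↑ʳ a b (T ∘ suc))) (sym (+-assoc (T zero) _ _))

allMaps-complete : ∀ n m (f : Fin n → Fin m) → Any (f ≗_) (allMaps n m)
allMaps-complete zero    m f = here (λ ())
allMaps-complete (suc n) m f = concatMap⁺ _ (tabulate⁺ (f zero) (map⁺ (Any.map
  (λ f∘suc≗g → λ { zero → refl ; (suc i) → f∘suc≗g i }) (allMaps-complete n m (f ∘ suc)))))

-- allMaps extends maps by its own pattern lambda, which agrees with Vector._∷_ only pointwise.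
count-allMaps-suc : (Q : (Fin (suc n) → Fin m) → Bool) → Q Preserves _≗_ ⟶ _≡_ →
  count Q (allMaps (suc n) m) ≡ sum (λ x → count (λ f → Q (x Vector.∷ f)) (allMaps n m))
count-allMaps-suc {n} {m} Q Q-ext =
  trans (count-concatMap-tabulate {n = m} Q _ id) (sum-cong-≗ λ x →
    trans (count-map Q _ (allMaps n m))
          (count-cong {q = λ f → Q (x Vector.∷ f)} (λ f → Q-ext λ { zero → refl ; (suc i) → refl }) (allMaps n m)))

-- The hypothesis on π says that every fibre of π has exactly c elements.
count-allMaps-∘ : (π : Fin m′ → Fin m) (c : ℕ) → (∀ T → sum (T ∘ π) ≡ c * sum T) →
  ∀ n (Q : (Fin n → Fin m) → Bool) → Q Preserves _≗_ ⟶ _≡_ →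
  count (λ f → Q (π ∘ f)) (allMaps n m′) ≡ c ^ n * count Q (allMaps n m)
count-allMaps-∘ π c fibres zero Q Q-ext =
  trans (count-[-] (λ f → Q (π ∘ f)) Q (Q-ext (λ ()))) (sym (*-identityˡ _))
count-allMaps-∘ {m′} {m} π c fibres (suc n) Q Q-ext = begin
  count (λ f → Q (π ∘ f)) (allMaps (suc n) m′)
    ≡⟨ count-allMaps-suc _ (Q-ext ∘ (cong π ∘_)) ⟩
  sum (λ y → count (λ f → Q (π ∘ (y Vector.∷ f))) (allMaps n m′))
    ≡⟨ sum-cong-≗ (λ y → count-cong (λ f → Q-ext (π∘∷ y f)) (allMaps n m′)) ⟩
  sum (λ y → count (λ f → Q (π y Vector.∷ π ∘ f)) (allMaps n m′))
    ≡⟨ sum-cong-≗ (λ y → count-allMaps-∘ π c fibres n (Q ∘ (π y Vector.∷_)) (Q-ext ∘ ∷-cong (π y))) ⟩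
  sum (λ y → T (π y))
    ≡⟨ fibres T ⟩
  c * sum T
    ≡⟨ cong (c *_) (*-distribˡ-sum (c ^ n) (λ x → count (Q ∘ (x Vector.∷_)) (allMaps n m))) ⟨
  c * (c ^ n * sum (λ x → count (Q ∘ (x Vector.∷_)) (allMaps n m)))
    ≡⟨ *-assoc c (c ^ n) _ ⟨
  c ^ suc n * sum (λ x → count (Q ∘ (x Vector.∷_)) (allMaps n m))
    ≡⟨ cong (c ^ suc n *_) (count-allMaps-suc Q Q-ext) ⟨
  c ^ suc n * count Q (allMaps (suc n) m) ∎
  where
  open ≡-Reasoning
  T : Vector ℕ m
  T x = c ^ n * count (Q ∘ (x Vector.∷_)) (allMaps n m)
  π∘∷ : ∀ y (f : Fin n → Fin m′) → π ∘ (y Vector.∷ f) ≗ π y Vector.∷ π ∘ f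
  π∘∷ y f zero    = refl
  π∘∷ y f (suc i) = refl
  ∷-cong : ∀ x {f g : Fin n → Fin m} → f ≗ g → x Vector.∷ f ≗ x Vector.∷ g
  ∷-cong x f≗g zero    = refl
  ∷-cong x f≗g (suc i) = f≗g i

allB-cong : (p q : Fin n → Bool) → p ≗ q → allB n p ≡ allB n q
allB-cong {zero}  p q p≗q = refl
allB-cong {suc n} p q p≗q = cong₂ _∧_ (p≗q zero) (allB-cong (p ∘ suc) (q ∘ suc) (p≗q ∘ suc))

allB-true : (p : Fin n → Bool) → (∀ i → p i ≡ true) → allB n p ≡ true
allB-true {zero}  p all-true = refl
allB-true {suc n} p all-true rewrite all-true zero = allB-true (p ∘ suc) (all-true ∘ suc)

isHom-≗ : (G : Graph n) (F : Graph m) → isHom G F Preserves _≗_ ⟶ _≡_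
isHom-≗ G F f≗g = allB-cong _ _ λ i → allB-cong _ _ λ j →
  cong (λ b → if adj G i j then b else true) (cong₂ (adj F) (f≗g i) (f≗g j))

hom-positive : (G : Graph n) (F : Graph m) (f : Fin n → Fin m) → isHom G F f ≡ true → 0 < hom G F
hom-positive G F f f-hom = filter-some (λ g → isHom G F g ≟ true)
  (Any.map (λ f≗g → trans (sym (isHom-≗ G F f≗g)) f-hom) (allMaps-complete _ _ f))

pullback : Graph m → (Fin m′ → Fin m) → Graph m′
pullback F π = record
  { adj   = λ i j → adj F (π i) (π j)
  ; sym   = λ i j → Graph.sym F (π i) (π j)
  ; irref = λ i → irref F (π i)
  }

hom-pullback : (π : Fin m′ → Fin m) (c : ℕ) → (∀ T → sum (T ∘ π) ≡ c * sum T) →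
  (G : Graph n) (F : Graph m) → hom G (pullback F π) ≡ c ^ n * hom G F
hom-pullback π c fibres G F = count-allMaps-∘ π c fibres _ (isHom G F) (isHom-≗ G F)

fold : ∀ k → Fin (k + k) → Fin k
fold k = id Vector.++ id

sum-∘fold : (T : Vector ℕ k) → sum (T ∘ fold k) ≡ 2 * sum T
sum-∘fold {k} T = begin
  sum (T ∘ fold k)
    ≡⟨ sum-↑ˡ-↑ʳ k k (T ∘ fold k) ⟩
  sum (T ∘ fold k ∘ (_↑ˡ k)) + sum (T ∘ fold k ∘ (k ↑ʳ_))
    ≡⟨ cong₂ _+_ (sum-cong-≗ (cong T ∘ lookup-++ˡ id id)) (sum-cong-≗ (cong T ∘ lookup-++ʳ id id)) ⟩
  sum T + sum T
    ≡⟨ cong (sum T +_) (+-identityʳ (sum T)) ⟨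
  2 * sum T ∎
  where open ≡-Reasoning

does-≟-sym : (i j : Fin n) → does (i ≟ᶠ j) ≡ does (j ≟ᶠ i)
does-≟-sym i j with i ≟ᶠ j
... | yes i≡j = sym (dec-true (j ≟ᶠ i) (sym i≡j))
... | no  i≢j = sym (dec-false (j ≟ᶠ i) (i≢j ∘ sym))

completeGraph : ∀ n → Graph n
completeGraph n = record
  { adj   = λ i j → not (does (i ≟ᶠ j))
  ; sym   = λ i j → cong not (does-≟-sym i j)
  ; irref = λ i → cong not (dec-true (i ≟ᶠ i) refl)
  }

injective⇒isHom-complete : (G : Graph n) (f : Fin n → Fin m) → Injective _≡_ _≡_ f →
  isHom G (completeGraph m) f ≡ true
injective⇒isHom-complete G f f-inj = allB-true _ λ i → allB-true _ λ j → edge i j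
  where
  edge : ∀ i j → (if adj G i j then not (does (f i ≟ᶠ f j)) else true) ≡ true
  edge i j with adj G i j in ij-edge | f i ≟ᶠ f j
  ... | false | _       = refl
  ... | true  | no  _   = refl
  ... | true  | yes fi≡fj with refl ← f-inj fi≡fj = contradiction (trans (sym ij-edge) (irref G i)) λ ()

hom-complete-positive : (G : Graph n) → n ≤ m → 0 < hom G (completeGraph m)
hom-complete-positive G n≤m = hom-positive G (completeGraph _) (λ i → inject≤ i n≤m)
  (injective⇒isHom-complete G _ (λ {i} {j} → inject≤-injective n≤m n≤m i j))

m+m≤m*m*m : 2 ≤ m → m + m ≤ m * m * m
m+m≤m*m*m {m} 2≤m@(s≤s (s≤s z≤n)) = begin
  m + m      ≡⟨ cong (m +_) (+-identityʳ m) ⟨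
  2 * m      ≤⟨ *-monoˡ-≤ m 2≤m ⟩
  m * m      ≤⟨ m≤m*n (m * m) m ⟩
  m * m * m  ∎
  where open ≤-Reasoning

lemma9p7 : (k : ℕ) → 2 ≤ k →
    ¬ (Σ ℕ λ n → Σ ℕ λ m → Σ (Graph (suc n)) λ G → Σ (Graph (suc m)) λ H →
         ((p : ℕ) → suc p ≤ k * k * k → (F : Graph (suc p)) → hom G F ≡ hom H F)
         × (suc n ≤ k) × (k < suc m))
lemma9p7 k@(suc (suc q)) 2≤k@(s≤s (s≤s z≤n)) (n , m , G , H , homs-agree , |G|≤k , k<|H|) =
  <-irrefl counts-agree (*-monoˡ-< a {{>-nonZero a-positive}} 2^|G|<2^|H|)
  where
  K : Graph k
  K = completeGraph k
  K² : Graph (k + k)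
  K² = pullback K (fold k)
  a : ℕ
  a = hom G K
  a-positive : 0 < a
  a-positive = hom-complete-positive G |G|≤k
  2^|G|<2^|H| : 2 ^ suc n < 2 ^ suc m
  2^|G|<2^|H| = ^-monoʳ-< 2 (s≤s (s≤s z≤n)) (≤-<-trans |G|≤k k<|H|)
  counts-agree : 2 ^ suc n * a ≡ 2 ^ suc m * a
  counts-agree = begin
    2 ^ suc n * a        ≡⟨ hom-pullback (fold k) 2 sum-∘fold G K ⟨
    hom G K²             ≡⟨ homs-agree (suc q + k) (m+m≤m*m*m 2≤k) K² ⟩
    hom H K²             ≡⟨ hom-pullback (fold k) 2 sum-∘fold H K ⟩
    2 ^ suc m * hom H K  ≡⟨ cong (2 ^ suc m *_) (homs-agree (suc q) (≤-trans (m≤m+n k k) (m+m≤m*m*m 2≤k)) K) ⟨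
    2 ^ suc m * a        ∎
    where open ≡-Reasoning
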